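{- Let $G=(V,E)$ be a connected graph with positive edge weights $\omega$, $n=|V|$, $m=|E|$, let $k\ge 1$ be an integer, let $q$ be a number with $\frac{1}{2k-1}<q<k$, and let $1<\rho\le 2$. Let $T=(V,E_T)$, $\mathcal{L}$, $L$, $\ell$, $E_0,E_1,\dots,E_\ell$, $\xi_j$ and $E^*_j$ ($1\le j\le \ell$) be as produced by the construction described in the context. Define $str(k,q)=(2k-1)\cdot\left(1+\frac{2}{q}\right)+\frac{2}{q}$. Then for every $1\le j\le \ell$ and every edge $e=(u,v)\in E_j$, there is a path between $u$ and $v$ in the graph $(V,E^*_j\cup E_T)$ whose weight is at most $str(k,q)\cdot\omega(e)$.
   Context: Construction (Algorithm LightSp with parameters $k,q,\rho$). Let $T=(V,E_T)$ be a minimum spanning tree of $G$ (or a spanning tree of weight $O(\omega(MST(G)))$), and let $dist_T$ denote the shortest-path distance in $T$. Let $\mathcal{L}=(v_1,\dots,v_n)$ be the ordering of $V$ given by a preorder traversal of $T$, viewed as a path in which consecutive vertices $v_i,v_{i+1}$ are joined with length $dist_T(v_i,v_{i+1})$; place $\mathcal{L}$ on a segment $[0,L]$, where $L=\sum_{i=1}^{n-1}dist_T(v_i,v_{i+1})$ and $v_i$ sits at position $\sum_{i'<i}dist_T(v_{i'},v_{i'+1})$. Let $\ell=\lceil\log_\rho n\rceil$. Let $E_0$ be the set of edges of weight in $(0,L/n]$, and for $1\le j\le\ell$ let $\xi_j=\rho^{j-1}\cdot L/n$ and let $E_j$ be the set of edges of weight in $(\xi_j,\rho\xi_j]$. A $t$-spanner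 of a weighted graph $H=(U,F)$ is a subgraph $(U,F')$, $F'\subseteq F$, with $dist_{(U,F')}(x,y)\le t\cdot dist_H(x,y)$ for every edge $(x,y)\in F$. The black-box spanner algorithm (of Baswana–Sen, derandomized by Roditty–Thorup–Zwick) computes, for any weighted graph with $N$ vertices and $M$ edges, a $(2k-1)$-spanner with $O(k\cdot N^{1+1/k})$ edges in $O(k\cdot M)$ time. Let $H'_0=(V,E'_0)$ be the $(2k-1)$-spanner of $(V,E_0)$ produced by it. For each $1\le j\le\ell$: divide $\mathcal{L}$ into $n_j=q n/\rho^{j-1}$ consecutive intervals, each of length $\mu_j=\xi_j/q$; these induce a partition of $V$ (a vertex on the boundary of two intervals is assigned to one of them arbitrarily). Introduce a new dummy vertex (the representative) for each interval, let $V_j$ be the set of representatives, and for $v\in V$ let $r_j(v)$ be the representative of the interval containing $v$. Let $\bar E_j$ be the set of edges of $E_j$ whose endpoints lie in different intervals. For each $e=(u,v)\in\bar E_j$ form the edge $(r_j(u),r_j(v))$ of weight $\omega(e)$, with source edge $e$; among parallel such edges keep only one of minimum weight (remembering its source edge), obtaining a simple graph $\tilde G_j=(V_j,\tilde E_j)$. Let $H'_j=(V_j,E'_j)$ be the $(2k-1)$-spanner of $\tilde G_j$ produced by the black-box algorithm, and let $E^*_j\subseteq E_j$ be the set of source edges of the edges of $E'_j$. Finally $E^*=E_T\cup E'_0\cup\bigcup_{j=1}^{\ell}E^*_j$ and $H^*=(V,E^*)$.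
   Formalization: The edge weights ω and the parameters q and ρ are rational, so L, $\xi_j$ and $\mu_j$ are rational as well. -}

module Defs where

open import Level using (0ℓ)
open import Data.Nat as ℕ using (ℕ; zero; suc)
open import Data.Integer using (+_)
open import Data.Fin using (Fin)
open import Data.Rational using (ℚ; 0ℚ; 1ℚ; _+_; _*_; _-_; _÷_; _/_; _≤_; _<_; NonZero)
open import Data.List using (List; []; _∷_; _++_; length; map)
open import Data.List.Membership.Propositional using (_∈_)
open import Data.List.Relation.Unary.Unique.Propositional using (Unique)
open import Data.Product using (Σ; ∃; ∃-syntax; _×_; _,_; proj₁; proj₂)
open import Data.Sum using (_⊎_)
open import Relation.Nullary using (¬_)
open import Relation.Binary.PropositionalEquality using (_≡_; _≢_)

ℕ→ℚ : ℕ → ℚ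
ℕ→ℚ m = + m / 1

infixr 8 _^_
_^_ : ℚ → ℕ → ℚ
x ^ zero  = 1ℚ
x ^ suc j = x * (x ^ j)

-- 1 / (2k-1), for k ≥ 1 (written k = suc k', so 2k-1 = 2k'+1);
-- the value at k = 0 is irrelevant (the theorem assumes k ≥ 1)
recip2k-1 : ℕ → ℚ
recip2k-1 zero    = 0ℚ
recip2k-1 (suc k) = + 1 / suc (2 ℕ.* k)

str : ℕ → (q : ℚ) → .{{NonZero q}} → ℚ
str k q = ℕ→ℚ (2 ℕ.* k ℕ.∸ 1) * (1ℚ + ℕ→ℚ 2 ÷ q) + ℕ→ℚ 2 ÷ q

record WEdge (V : Set) : Set where
  constructor wedge
  field
    src : V
    tgt : V
    wt  : ℚ
open WEdge public

SamePair : {V : Set} → V → V → V → V → Set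
SamePair a b c d = (a ≡ c × b ≡ d) ⊎ (a ≡ d × b ≡ c)

data Walk {V : Set} (F : WEdge V → Set) : V → V → ℚ → Set where
  []  : ∀ {x} → Walk F x x 0ℚ
  fwd : ∀ {x z w} (e : WEdge V) → F e → src e ≡ x →
        Walk F (tgt e) z w → Walk F x z (wt e + w)
  bwd : ∀ {x z w} (e : WEdge V) → F e → tgt e ≡ x →
        Walk F (src e) z w → Walk F x z (wt e + w)

Connected : {V : Set} → (WEdge V → Set) → Set
Connected {V} F = (x y : V) → ∃[ w ] Walk F x y w

record PosSimpleGraph (n : ℕ) (E : List (WEdge (Fin n))) : Set where
  field
    positive : ∀ e → e ∈ E → 0ℚ < wt e
    noLoop   : ∀ e → e ∈ E → src e ≢ tgt e
    noParallel : ∀ e f → e ∈ E → f ∈ E →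
                 SamePair (src e) (tgt e) (src f) (tgt f) → e ≡ f

_⊆ᴱ_ : {A : Set} → List A → List A → Set
A ⊆ᴱ B = ∀ e → e ∈ A → e ∈ B

-- T is a spanning tree of (Fin n, E): a connected spanning subgraph that
-- is acyclic, i.e. no edge of T lies on a cycle of T (the endpoints of
-- any tree edge are disconnected once that edge is removed)
record SpanningTree (n : ℕ) (E T : List (WEdge (Fin n))) : Set where
  field
    sub       : T ⊆ᴱ E
    distinct  : Unique T
    connected : Connected (λ e → e ∈ T)
    acyclic   : ∀ e → e ∈ T → ∀ w →
                ¬ Walk (λ f → f ∈ T × f ≢ e) (src e) (tgt e) w

record IsDist {V : Set} (F : WEdge V → Set) (d : V → V → ℚ) : Set where
  field
    attained : ∀ x y → Walk F x y (d x y)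
    minimal  : ∀ x y w → Walk F x y w → d x y ≤ w

data RTree (V : Set) : Set where
  node : V → List (RTree V) → RTree V

mutual
  preorder : {V : Set} → RTree V → List V
  preorder (node v ts) = v ∷ preorders ts

  preorders : {V : Set} → List (RTree V) → List V
  preorders []       = []
  preorders (t ∷ ts) = preorder t ++ preorders ts

root : {V : Set} → RTree V → V
root (node v _) = v

mutual
  treeEdges : {V : Set} → RTree V → List (V × V)
  treeEdges (node v ts) = map (λ t → v , root t) ts ++ treeEdgesL ts

  treeEdgesL : {V : Set} → List (RTree V) → List (V × V)
  treeEdgesL []       = []
  treeEdgesL (t ∷ ts) = treeEdges t ++ treeEdgesL ts

-- ord is the vertex order of a preorder traversal of the tree T
-- (rooted at some vertex, with some ordering of the children)
record IsPreorderOf (n : ℕ) (T : List (WEdge (Fin n))) (ord : List (Fin n)) : Set where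
  field
    rtree     : RTree (Fin n)
    order     : ord ≡ preorder rtree
    allVerts  : ∀ v → v ∈ ord
    once      : Unique ord
    edgesInT  : ∀ p c → (p , c) ∈ treeEdges rtree →
                ∃[ e ] (e ∈ T × SamePair p c (src e) (tgt e))
    edgesOfT  : ∀ e → e ∈ T →
                ∃[ p ] ∃[ c ] ((p , c) ∈ treeEdges rtree × SamePair p c (src e) (tgt e))

placed : {V : Set} → (V → V → ℚ) → ℚ → List V → List (V × ℚ)
placed d a []            = []
placed d a (x ∷ [])      = (x , a) ∷ []
placed d a (x ∷ y ∷ xs)  = (x , a) ∷ placed d (a + d x y) (y ∷ xs)

lineLength : {V : Set} → (V → V → ℚ) → List V → ℚ
lineLength d []           = 0ℚ
lineLength d (x ∷ [])     = 0ℚ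
lineLength d (x ∷ y ∷ xs) = d x y + lineLength d (y ∷ xs)

-- ℓ = ⌈log_ρ n⌉ : the least natural number ℓ with n ≤ ρ^ℓ
IsCeilLog : ℚ → ℕ → ℕ → Set
IsCeilLog ρ n ℓ = (ℕ→ℚ n ≤ ρ ^ ℓ) × (∀ m → ℕ→ℚ n ≤ ρ ^ m → ℓ ℕ.≤ m)

-- Edges of G̃_j are stored together with their source edges:
-- a pair (t , s) means t = (r(src s), r(tgt s)) with weight ω(s).
CEdge : ℕ → Set
CEdge n = WEdge ℕ × WEdge (Fin n)

cedges : {n : ℕ} → List (CEdge n) → WEdge ℕ → Set
cedges C t = ∃[ s ] ((t , s) ∈ C)

sources : {n : ℕ} → List (CEdge n) → WEdge (Fin n) → Set
sources C s = ∃[ t ] ((t , s) ∈ C)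

-- C is the edge set of G̃_j, built from the edges Ē (predicate) and the
-- representative map r: every e ∈ Ē yields the edge (r u, r v) of weight
-- ω(e); among parallel ones exactly one of minimum weight is kept.
record IsContraction {n : ℕ} (Ebar : WEdge (Fin n) → Set) (r : Fin n → ℕ)
                     (C : List (CEdge n)) : Set where
  field
    fromSource : ∀ t s → (t , s) ∈ C →
                 Ebar s × t ≡ wedge (r (src s)) (r (tgt s)) (wt s)
    covers     : ∀ e → Ebar e → ∃[ t ] ∃[ s ] ((t , s) ∈ C ×
                 SamePair (r (src e)) (r (tgt e)) (src t) (tgt t) × wt s ≤ wt e)
    simple     : ∀ t s t' s' → (t , s) ∈ C → (t' , s') ∈ C →
                 SamePair (src t) (tgt t) (src t') (tgt t') → (t , s) ≡ (t' , s')

record IsSpanner {n : ℕ} (σ : ℚ) (C S : List (CEdge n)) : Set where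
  field
    subset  : S ⊆ᴱ C
    stretch : ∀ t s → (t , s) ∈ C → ∀ w → Walk (cedges C) (src t) (tgt t) w →
              ∃[ w' ] (Walk (cedges S) (src t) (tgt t) w' × w' ≤ σ * w)

module Submission where

-- Let e = (u,v) ∈ E_j. The spanner H'_j joins the representatives r(u), r(v)
-- by a walk of weight w' ≤ (2k-1)·ω(e) (trivially, if r(u) = r(v)). Every edge
-- of that walk comes from a source edge of E_j, so it weighs more than ξ_j and
-- hence at least q·μ_j. Lifting the walk to G, each contracted edge is replaced
-- by its source edge, and between consecutive source edges (and at both ends)
-- we travel inside one interval of the line 𝓛, which costs at most μ_j along
-- the tree T. So the lifted walk weighs at most μ_j + w'·(1 + 1/q) with
-- μ_j < ω(e)/q, which is below str(k,q)·ω(e).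

open import Defs
open import Data.Nat as ℕ using (ℕ)
open import Data.Integer using (+_)
open import Data.Fin using (Fin)
open import Data.Rational using (ℚ; 0ℚ; 1ℚ; _+_; _*_; _-_; _÷_; _/_; _≤_; _<_; NonZero; NonNegative; 1/_; nonNegative; positive)
open import Data.Rational.Properties as ℚP using (module ≤-Reasoning)
open import Data.Rational.Solver using (module +-*-Solver)
open import Data.List using (List; []; _∷_)
open import Data.List.Membership.Propositional using (_∈_)
open import Data.List.Relation.Unary.Any using (here; there)
open import Data.Product using (∃-syntax; _×_; _,_; proj₁; proj₂)
open import Data.Sum using (_⊎_; inj₁; inj₂)
open import Relation.Binary.PropositionalEquality using (_≡_; _≢_; refl; sym; trans; subst)
open import Relation.Nullary using (yes; no)

open +-*-Solver using (solve; _:+_; _:*_; _:-_; _:=_; con)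

swapWeights : ∀ a w → w + (a + 0ℚ) ≡ a + w
swapWeights = solve 2 (λ a w → w :+ (a :+ con 0ℚ) := a :+ w) refl

module _ {V : Set} {F : WEdge V → Set} where

  appendWalk : ∀ {x y z a b} → Walk F x y a → Walk F y z b → Walk F x z (a + b)
  appendWalk {b = b} [] p = subst (Walk F _ _) (sym (ℚP.+-identityˡ b)) p
  appendWalk {b = b} (fwd {w = w} e f eq p) p' =
    subst (Walk F _ _) (sym (ℚP.+-assoc (wt e) w b)) (fwd e f eq (appendWalk p p'))
  appendWalk {b = b} (bwd {w = w} e f eq p) p' =
    subst (Walk F _ _) (sym (ℚP.+-assoc (wt e) w b)) (bwd e f eq (appendWalk p p'))

  reverseWalk : ∀ {x y a} → Walk F x y a → Walk F y x a
  reverseWalk [] = []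
  reverseWalk (fwd {w = w} e f refl p) =
    subst (Walk F _ _) (swapWeights (wt e) w) (appendWalk (reverseWalk p) (bwd e f refl []))
  reverseWalk (bwd {w = w} e f refl p) =
    subst (Walk F _ _) (swapWeights (wt e) w) (appendWalk (reverseWalk p) (fwd e f refl []))

mapWalk : ∀ {V : Set} {F G : WEdge V → Set} → (∀ f → F f → G f) →
          ∀ {x y a} → Walk F x y a → Walk G x y a
mapWalk h [] = []
mapWalk h (fwd e f eq p) = fwd e (h e f) eq (mapWalk h p)
mapWalk h (bwd e f eq p) = bwd e (h e f) eq (mapWalk h p)

WalkLe : {V : Set} → (WEdge V → Set) → V → V → ℚ → Set
WalkLe F x y b = ∃[ w ] (Walk F x y w × w ≤ b)

module _ {V : Set} {F : WEdge V → Set} where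

  weakenLe : ∀ {x y a b} → WalkLe F x y a → a ≤ b → WalkLe F x y b
  weakenLe (w , p , w≤a) a≤b = w , p , ℚP.≤-trans w≤a a≤b

  appendLe : ∀ {x y z a b} → WalkLe F x y a → WalkLe F y z b → WalkLe F x z (a + b)
  appendLe (w , p , w≤a) (w' , p' , w'≤b) = w + w' , appendWalk p p' , ℚP.+-mono-≤ w≤a w'≤b

  reverseLe : ∀ {x y b} → WalkLe F x y b → WalkLe F y x b
  reverseLe (w , p , w≤b) = w , reverseWalk p , w≤b

  edgeLe : ∀ e → F e → WalkLe F (src e) (tgt e) (wt e)
  edgeLe e f = wt e + 0ℚ , fwd e f refl [] , ℚP.≤-reflexive (ℚP.+-identityʳ (wt e))

  edgeLe⁻ : ∀ e → F e → WalkLe F (tgt e) (src e) (wt e)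
  edgeLe⁻ e f = reverseLe (edgeLe e f)

  mapLe : ∀ {G : WEdge V → Set} → (∀ f → F f → G f) → ∀ {x y b} → WalkLe F x y b → WalkLe G x y b
  mapLe h (w , p , w≤b) = w , mapWalk h p , w≤b

intervalGap : ∀ c μ {a b} → c * μ ≤ a → b ≤ (c + 1ℚ) * μ → b - a ≤ μ
intervalGap c μ {a} {b} ca b≤ = begin
  b - a                 ≤⟨ ℚP.+-mono-≤ b≤ (ℚP.neg-antimono-≤ ca) ⟩
  (c + 1ℚ) * μ - c * μ  ≡⟨ solve 2 (λ c μ → (c :+ con 1ℚ) :* μ :- c :* μ := μ) refl c μ ⟩
  μ                     ∎
  where open ≤-Reasoning

module Line {V : Set} (F : WEdge V → Set) (d : V → V → ℚ)
            (attained : ∀ x y → Walk F x y (d x y)) where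

  gapRefl : ∀ a → 0ℚ ≤ a - a
  gapRefl a = ℚP.≤-reflexive (sym (ℚP.+-inverseʳ a))

  fromHead : ∀ a x xs {z p} → (z , p) ∈ placed d a (x ∷ xs) → WalkLe F x z (p - a)
  fromHead a x []       (here refl) = 0ℚ , [] , gapRefl a
  fromHead a x (y ∷ xs) (here refl) = 0ℚ , [] , gapRefl a
  fromHead a x (y ∷ xs) {p = p} (there m) =
    weakenLe (appendLe (d x y , attained x y , ℚP.≤-refl) (fromHead (a + d x y) y xs m))
             (ℚP.≤-reflexive (telescope a (d x y) p))
    where telescope : ∀ a b c → b + (c - (a + b)) ≡ c - a
          telescope = solve 3 (λ a b c → b :+ (c :- (a :+ b)) := c :- a) refl

  placedWalk : ∀ a xs {x p y p'} → (x , p) ∈ placed d a xs → (y , p') ∈ placed d a xs →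
               ∀ b → p' - p ≤ b → p - p' ≤ b → WalkLe F x y b
  placedWalk a (z ∷ []) (here refl) my b gap _ = weakenLe (fromHead a z [] my) gap
  placedWalk a (z ∷ z' ∷ zs) (here refl) my b gap _ = weakenLe (fromHead a z (z' ∷ zs) my) gap
  placedWalk a (z ∷ z' ∷ zs) (there mx) (here refl) b _ gap =
    reverseLe (weakenLe (fromHead a z (z' ∷ zs) (there mx)) gap)
  placedWalk a (z ∷ z' ∷ zs) (there mx) (there my) b gap gap' =
    placedWalk (a + d z z') (z' ∷ zs) mx my b gap gap'

  sameInterval : ∀ a xs (pos : V → ℚ) (μ : ℚ) (idx : V → ℕ) →
                 (∀ v → (v , pos v) ∈ placed d a xs) →
                 (∀ v → ℕ→ℚ (idx v) * μ ≤ pos v × pos v ≤ (ℕ→ℚ (idx v) + 1ℚ) * μ) →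
                 ∀ x y → idx x ≡ idx y → WalkLe F x y μ
  sameInterval a xs pos μ idx placedAt inInterval x y same =
    placedWalk a xs (placedAt x) (placedAt y) μ
      (intervalGap (ℕ→ℚ (idx x)) μ (lower x) (subst (λ c → pos y ≤ (ℕ→ℚ c + 1ℚ) * μ) (sym same) (upper y)))
      (intervalGap (ℕ→ℚ (idx y)) μ (lower y) (subst (λ c → pos x ≤ (ℕ→ℚ c + 1ℚ) * μ) same (upper x)))
    where
    lower : ∀ v → ℕ→ℚ (idx v) * μ ≤ pos v
    lower v = proj₁ (inInterval v)
    upper : ∀ v → pos v ≤ (ℕ→ℚ (idx v) + 1ℚ) * μ
    upper v = proj₂ (inInterval v)

-- The graph D on U is a contraction of F along r : V → U in which every
-- vertex class (cluster) has diameter at most μ in F, and every edge of D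
-- comes from an edge s of F with μ ≤ ω(s)·c. Then a walk of weight w in D
-- between the classes of x and y lifts to an F-walk from x to y of weight at
-- most μ + w·(1 + c): one cluster crossing per edge, plus one at the start.
module Lifting {V U : Set} (F : WEdge V → Set) (D : WEdge U → Set) (r : V → U) (μ c : ℚ)
               (cluster : ∀ x y → r x ≡ r y → WalkLe F x y μ)
               (heavySource : ∀ t → D t →
                  ∃[ s ] (F s × t ≡ wedge (r (src s)) (r (tgt s)) (wt s) × μ ≤ wt s * c)) where

  -- the cost of one lifted edge: the cluster crossing before it is paid by c·ω(s)
  stepBound : ∀ ws w → μ ≤ ws * c → μ + (ws + (μ + w * (1ℚ + c))) ≤ μ + (ws + w) * (1ℚ + c)
  stepBound ws w μ≤ = begin
    μ + (ws + (μ + w * (1ℚ + c)))        ≤⟨ ℚP.+-monoʳ-≤ μ (ℚP.+-monoʳ-≤ ws (ℚP.+-monoˡ-≤ _ μ≤)) ⟩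
    μ + (ws + (ws * c + w * (1ℚ + c)))   ≡⟨ solve 4 (λ μ ws w c →
                                              μ :+ (ws :+ (ws :* c :+ w :* (con 1ℚ :+ c)))
                                                := μ :+ (ws :+ w) :* (con 1ℚ :+ c)) refl μ ws w c ⟩
    μ + (ws + w) * (1ℚ + c)              ∎
    where open ≤-Reasoning

  lift : ∀ {a b w} → Walk D a b w → ∀ x y → r x ≡ a → r y ≡ b →
         WalkLe F x y (μ + w * (1ℚ + c))
  lift [] x y refl ry≡ = weakenLe (cluster x y (sym ry≡))
    (ℚP.≤-reflexive (solve 2 (λ μ c → μ := μ :+ con 0ℚ :* (con 1ℚ :+ c)) refl μ c))
  lift (fwd t d start p) x y rx≡ ry≡ with heavySource t d
  ... | s , fs , refl , μ≤ =
    weakenLe (appendLe (cluster x (src s) (trans rx≡ (sym start)))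
                       (appendLe (edgeLe s fs) (lift p (tgt s) y refl ry≡)))
             (stepBound (wt s) _ μ≤)
  lift (bwd t d start p) x y rx≡ ry≡ with heavySource t d
  ... | s , fs , refl , μ≤ =
    weakenLe (appendLe (cluster x (tgt s) (trans rx≡ (sym start)))
                       (appendLe (edgeLe⁻ s fs) (lift p (src s) y refl ry≡)))
             (stepBound (wt s) _ μ≤)

-- For an edge e of Ē, the contraction has an edge between r(u) and r(v) of
-- weight at most ω(e), which the σ-spanner replaces by a walk of weight at
-- most σ·ω(e).
spannerWalk : ∀ {n} {Ebar : WEdge (Fin n) → Set} {r : Fin n → ℕ} {C S : List (CEdge n)} {σ : ℚ} →
              0ℚ ≤ σ → IsContraction Ebar r C → IsSpanner σ C S →
              ∀ e → Ebar e → WalkLe (cedges S) (r (src e)) (r (tgt e)) (σ * wt e)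
spannerWalk {r = r} {C = C} {S = S} {σ = σ} σ≥0 isC isS e eE with IsContraction.covers isC e eE
... | t , s , m , samePair , ws≤we = orient samePair (IsSpanner.stretch isS t s m _ (edgeWalk t (s , m)))
  where
  edgeWalk : ∀ t → cedges C t → Walk (cedges C) (src t) (tgt t) (wt t + 0ℚ)
  edgeWalk t d = fwd t d refl []

  σ·wt≤ : σ * (wt t + 0ℚ) ≤ σ * wt e
  σ·wt≤ with IsContraction.fromSource isC t s m
  ... | _ , refl = ℚP.*-monoˡ-≤-nonNeg σ {{nonNegative σ≥0}}
                     (subst (_≤ wt e) (sym (ℚP.+-identityʳ (wt s))) ws≤we)

  orient : SamePair (r (src e)) (r (tgt e)) (src t) (tgt t) →
           WalkLe (cedges S) (src t) (tgt t) (σ * (wt t + 0ℚ)) →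
           WalkLe (cedges S) (r (src e)) (r (tgt e)) (σ * wt e)
  orient (inj₁ (refl , refl)) walk = weakenLe walk σ·wt≤
  orient (inj₂ (refl , refl)) walk = reverseLe (weakenLe walk σ·wt≤)

representativeWalk : ∀ {n} {P : WEdge (Fin n) → Set} {r : Fin n → ℕ} {C S : List (CEdge n)} {σ : ℚ} →
                     0ℚ ≤ σ → IsContraction (λ e → P e × r (src e) ≢ r (tgt e)) r C →
                     IsSpanner σ C S →
                     ∀ e → P e → 0ℚ ≤ wt e → WalkLe (cedges S) (r (src e)) (r (tgt e)) (σ * wt e)
representativeWalk {r = r} {S = S} {σ = σ} σ≥0 isC isS e pe ω≥0 with r (src e) ℕ.≟ r (tgt e)
... | yes same = 0ℚ , subst (λ b → Walk (cedges S) (r (src e)) b 0ℚ) same [] ,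
                 ℚP.nonNegative⁻¹ _ {{ℚP.nonNeg*nonNeg⇒nonNeg σ {{nonNegative σ≥0}} (wt e) {{nonNegative ω≥0}}}}
... | no differ = spannerWalk σ≥0 isC isS e (pe , differ)

recip≥0 : ∀ k (q : ℚ) .{{_ : NonZero q}} → 1 ℕ.≤ k → recip2k-1 k < q → 0ℚ ≤ 1/ q
recip≥0 (ℕ.suc k') q _ 1/[2k-1]<q = ℚP.<⇒≤ (ℚP.positive⁻¹ _ {{ℚP.1/pos⇒pos q {{positive q>0}}}})
  where q>0 : 0ℚ < q
        q>0 = ℚP.≤-<-trans (ℚP.nonNegative⁻¹ _ {{ℚP.normalize-nonNeg 1 (ℕ.suc (2 ℕ.* k'))}}) 1/[2k-1]<q

finalBound : ∀ K iq ω w' μ → 0ℚ ≤ K → 0ℚ ≤ iq → 0ℚ ≤ ω → w' ≤ K * ω → μ ≤ ω * iq →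
             μ + w' * (1ℚ + iq) ≤ (K * (1ℚ + ℕ→ℚ 2 * iq) + ℕ→ℚ 2 * iq) * ω
finalBound K iq ω w' μ K≥0 iq≥0 ω≥0 w'≤ μ≤ = begin
  μ + w' * (1ℚ + iq)                                  ≤⟨ ℚP.+-mono-≤ μ≤ (ℚP.*-monoʳ-≤-nonNeg (1ℚ + iq) {{onePlus}} w'≤) ⟩
  ω * iq + K * ω * (1ℚ + iq)                          ≡⟨ sym (ℚP.+-identityʳ _) ⟩
  ω * iq + K * ω * (1ℚ + iq) + 0ℚ                     ≤⟨ ℚP.+-monoʳ-≤ (ω * iq + K * ω * (1ℚ + iq)) slack ⟩
  ω * iq + K * ω * (1ℚ + iq) + (K + 1ℚ) * (iq * ω)    ≡⟨ solve 3 (λ K iq ω →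
      ω :* iq :+ K :* ω :* (con 1ℚ :+ iq) :+ (K :+ con 1ℚ) :* (iq :* ω)
        := (K :* (con 1ℚ :+ con (ℕ→ℚ 2) :* iq) :+ con (ℕ→ℚ 2) :* iq) :* ω) refl K iq ω ⟩
  (K * (1ℚ + ℕ→ℚ 2 * iq) + ℕ→ℚ 2 * iq) * ω            ∎
  where
  open ≤-Reasoning
  instance
    iqNonNeg : NonNegative iq
    iqNonNeg = nonNegative iq≥0
    ωNonNeg : NonNegative ω
    ωNonNeg = nonNegative ω≥0
    KNonNeg : NonNegative K
    KNonNeg = nonNegative K≥0
  onePlus : NonNegative (1ℚ + iq)
  onePlus = ℚP.nonNeg+nonNeg⇒nonNeg 1ℚ iq
  -- the surplus (K + 1)·ω/q separating the bound proved from str(k,q)·ω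
  slack : 0ℚ ≤ (K + 1ℚ) * (iq * ω)
  slack = ℚP.nonNegative⁻¹ _ {{ℚP.nonNeg*nonNeg⇒nonNeg (K + 1ℚ) {{ℚP.nonNeg+nonNeg⇒nonNeg K 1ℚ}}
                                 (iq * ω) {{ℚP.nonNeg*nonNeg⇒nonNeg iq ω}}}}

lemma2p1 :
  -- the graph G = (Fin n, E): connected, simple, positive weights
  (n : ℕ) .{{_ : ℕ.NonZero n}} (E : List (WEdge (Fin n))) →
  PosSimpleGraph n E → Connected (λ e → e ∈ E) →
  -- parameters k ≥ 1, 1/(2k-1) < q < k, 1 < ρ ≤ 2
  (k : ℕ) → 1 ℕ.≤ k →
  (q : ℚ) .{{_ : NonZero q}} → recip2k-1 k < q → q < ℕ→ℚ k →
  (ρ : ℚ) .{{_ : NonZero ρ}} → 1ℚ < ρ → ρ ≤ ℕ→ℚ 2 →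
  -- the spanning tree T, its distance dist_T, the preorder line 𝓛 on [0,L]
  (T : List (WEdge (Fin n))) → SpanningTree n E T →
  (distT : Fin n → Fin n → ℚ) → IsDist (λ e → e ∈ T) distT →
  (ord : List (Fin n)) → IsPreorderOf n T ord →
  (pos : Fin n → ℚ) → (∀ v → (v , pos v) ∈ placed distT 0ℚ ord) →
  -- ℓ = ⌈log_ρ n⌉
  (ℓ : ℕ) → IsCeilLog ρ n ℓ →
  -- a level 1 ≤ j ≤ ℓ, with ξ_j = ρ^{j-1} L / n, μ_j = ξ_j / q,
  -- n_j = q n / ρ^{j-1}
  (j : ℕ) → 1 ℕ.≤ j → j ℕ.≤ ℓ →
  let L  = lineLength distT ord
      ξ  = ρ ^ (j ℕ.∸ 1) * (L * (+ 1 / n))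
      μ  = ξ ÷ q
      nj = q * ℕ→ℚ n * (1/ ρ) ^ (j ℕ.∸ 1)
      Ej = λ (e : WEdge (Fin n)) → e ∈ E × ξ < wt e × wt e ≤ ρ * ξ
  in
  -- the partition of V into the n_j intervals of length μ_j:
  -- r v is the index of the interval containing v
  (r : Fin n → ℕ) →
  (∀ v → ℕ→ℚ (r v) < nj × ℕ→ℚ (r v) * μ ≤ pos v × pos v ≤ (ℕ→ℚ (r v) + 1ℚ) * μ) →
  -- G̃_j built from Ē_j, its (2k-1)-spanner H'_j, and E*_j = its source edges
  (C : List (CEdge n)) →
  IsContraction (λ e → Ej e × r (src e) ≢ r (tgt e)) r C →
  (S : List (CEdge n)) → IsSpanner (ℕ→ℚ (2 ℕ.* k ℕ.∸ 1)) C S →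
  -- conclusion
  ∀ e → Ej e →
  ∃[ w ] (Walk (λ f → sources S f ⊎ f ∈ T) (src e) (tgt e) w × w ≤ str k q * wt e)
lemma2p1 n E graph _ k k≥1 q 1/[2k-1]<q _ ρ _ _ T _ distT isDist ord _ pos posPlaced
         _ _ j _ _ r intervalOf C isC S isS e (e∈E , ξ<ω , ω≤ρξ) =
  conclude (representativeWalk K≥0 isC isS e (e∈E , ξ<ω , ω≤ρξ) ω≥0)
  where
  ξ μ iq K : ℚ
  ξ  = ρ ^ (j ℕ.∸ 1) * (lineLength distT ord * (+ 1 / n))
  μ  = ξ ÷ q
  iq = 1/ q
  K  = ℕ→ℚ (2 ℕ.* k ℕ.∸ 1)

  G : WEdge (Fin n) → Set
  G f = sources S f ⊎ f ∈ T

  K≥0 : 0ℚ ≤ K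
  K≥0 = ℚP.nonNegative⁻¹ _ {{ℚP.normalize-nonNeg (2 ℕ.* k ℕ.∸ 1) 1}}

  iq≥0 : 0ℚ ≤ iq
  iq≥0 = recip≥0 k q k≥1 1/[2k-1]<q

  ω≥0 : 0ℚ ≤ wt e
  ω≥0 = ℚP.<⇒≤ (PosSimpleGraph.positive graph e e∈E)

  -- an edge heavier than ξ_j pays for one crossing of an interval of length μ_j
  μ≤ : ∀ w → ξ < w → μ ≤ w * iq
  μ≤ w ξ<w = ℚP.*-monoʳ-≤-nonNeg iq {{nonNegative iq≥0}} (ℚP.<⇒≤ ξ<w)

  cluster : ∀ x y → r x ≡ r y → WalkLe G x y μ
  cluster x y same = mapLe (λ _ → inj₂)
    (Line.sameInterval (_∈ T) distT (IsDist.attained isDist) 0ℚ ord pos μ r posPlaced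
       (λ v → proj₂ (intervalOf v)) x y same)

  -- every spanner edge stems from an edge of Ē_j ⊆ E_j, hence heavier than ξ_j
  heavySource : ∀ t → cedges S t →
                ∃[ s ] (G s × t ≡ wedge (r (src s)) (r (tgt s)) (wt s) × μ ≤ wt s * iq)
  heavySource t (s , m) with IsContraction.fromSource isC t s (IsSpanner.subset isS (t , s) m)
  ... | ((_ , ξ<ws , _) , _) , t≡ = s , inj₁ (t , m) , t≡ , μ≤ (wt s) ξ<ws

  open Lifting G (cedges S) r μ iq cluster heavySource

  conclude : WalkLe (cedges S) (r (src e)) (r (tgt e)) (K * wt e) →
             ∃[ w ] (Walk G (src e) (tgt e) w × w ≤ str k q * wt e)
  conclude (w' , walk , w'≤) =
    weakenLe (lift walk (src e) (tgt e) refl refl)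
             (finalBound K iq (wt e) w' μ K≥0 iq≥0 ω≥0 w'≤ (μ≤ (wt e) ξ<ω))
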